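{- Let $\mathbf d=(d_1,\ldots,d_n)$ be a degree sequence with $M=\sum_i d_i$, $M_2=\sum_i d_i(d_i-1)$, $\Delta=\max_i d_i$. Let $G'\in\mathcal G_{m_1,m_2}$ with $m_1\le M_2/M$ and $m_2\le M_2^2/M^2$. Then $$M_2\Bigl(1-\frac{8m_2\Delta+m_1\Delta^2}{M_2}\Bigr)\le b_\ell(G',\emptyset)\le M_2.$$ For $G'\in\mathcal G_{0,m_2}$ with $m_2\le M_2^2/M^2$, $$M_2\Bigl(1-\frac{8m_2\Delta}{M_2}\Bigr)\le b_d(G',\emptyset)\le M_2.$$
   Context: $\mathcal G_{m_1,m_2}$ is the set of multigraphs on $\{v_1,\ldots,v_n\}$ with degree sequence $\mathbf d$ (a loop contributes 2 to the degree) having exactly $m_1$ loops of multiplicity one, no loop of higher multiplicity, exactly $m_2$ double edges (pairs of distinct vertices joined by exactly two parallel edges) and no pair of vertices joined by three or more edges. A single edge is a pair of distinct vertices joined by exactly one edge. A simple ordered 2-path $uvw$ is an ordered triple $(u,v,w)$ of distinct vertices with $uv$ and $vw$ single edges. $b_\ell(G',\emptyset)$ is the number of simple ordered 2-paths $uvw$ in $G'$ with no loop at $v$; $b_d(G',\emptyset)$ is the number of simple ordered 2-paths in $G'$. -}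

module Defs where

open import Data.Nat using (ℕ; zero; suc; _+_; _*_; _∸_; _⊔_; _≤_)
open import Data.Fin using (Fin; zero; suc; toℕ; _<?_)
open import Data.Fin.Properties using (_≟_)
open import Data.Product using (_×_)
open import Relation.Nullary using (Dec; yes; no; ¬_)
open import Relation.Nullary.Decidable using (_×-dec_; ¬?)
open import Relation.Binary.PropositionalEquality using (_≡_)
import Data.Nat as ℕ

∑ : ∀ {n} → (Fin n → ℕ) → ℕ
∑ {zero}  f = 0
∑ {suc n} f = f zero + ∑ (λ i → f (suc i))

maxF : ∀ {n} → (Fin n → ℕ) → ℕ
maxF {zero}  f = 0
maxF {suc n} f = f zero ⊔ maxF (λ i → f (suc i))

𝟙 : ∀ {p} {P : Set p} → Dec P → ℕ
𝟙 (yes _) = 1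
𝟙 (no _)  = 0

M : ∀ {n} → (Fin n → ℕ) → ℕ
M d = ∑ d

M₂ : ∀ {n} → (Fin n → ℕ) → ℕ
M₂ d = ∑ (λ i → d i * (d i ∸ 1))

Δ : ∀ {n} → (Fin n → ℕ) → ℕ
Δ d = maxF d

-- A (loopy) multigraph on vertex set Fin n:
-- loop v = number of loops at v, mult u w = number of edges between distinct u, w.
record Multigraph (n : ℕ) : Set where
  field
    loop   : Fin n → ℕ
    mult   : Fin n → Fin n → ℕ
    sym    : ∀ u w → mult u w ≡ mult w u
    irrefl : ∀ v → mult v v ≡ 0
open Multigraph public

deg : ∀ {n} → Multigraph n → Fin n → ℕ
deg G v = 2 * loop G v + ∑ (λ w → mult G v w)

HasDegrees : ∀ {n} → Multigraph n → (Fin n → ℕ) → Set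
HasDegrees G d = ∀ v → deg G v ≡ d v

numLoops : ∀ {n} → Multigraph n → ℕ
numLoops G = ∑ (λ v → 𝟙 (loop G v ℕ.≟ 1))

numDoubleEdges : ∀ {n} → Multigraph n → ℕ
numDoubleEdges G = ∑ (λ u → ∑ (λ w → 𝟙 ((u <? w) ×-dec (mult G u w ℕ.≟ 2))))

record InG {n} (d : Fin n → ℕ) (m₁ m₂ : ℕ) (G : Multigraph n) : Set where
  field
    degrees   : HasDegrees G d
    loops≤1   : ∀ v → loop G v ≤ 1
    mult≤2    : ∀ u w → mult G u w ≤ 2
    loopCount : numLoops G ≡ m₁
    dblCount  : numDoubleEdges G ≡ m₂

Simple2Path? : ∀ {n} → (G : Multigraph n) → (u v w : Fin n) →
  Dec ((¬ u ≡ v × ¬ v ≡ w × ¬ u ≡ w) × (mult G u v ≡ 1 × mult G v w ≡ 1))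
Simple2Path? G u v w =
  (¬? (u ≟ v) ×-dec (¬? (v ≟ w) ×-dec ¬? (u ≟ w)))
  ×-dec ((mult G u v ℕ.≟ 1) ×-dec (mult G v w ℕ.≟ 1))

b-d : ∀ {n} → Multigraph n → ℕ
b-d G = ∑ (λ u → ∑ (λ v → ∑ (λ w → 𝟙 (Simple2Path? G u v w))))

b-ℓ : ∀ {n} → Multigraph n → ℕ
b-ℓ G = ∑ (λ u → ∑ (λ v → ∑ (λ w →
          𝟙 (Simple2Path? G u v w ×-dec (loop G v ℕ.≟ 0)))))

module Submission where

-- For a vertex v of G ∈ 𝒢_{m₁,m₂} write S v for the number of
-- single-edge neighbours of v and D v for the number of double-edge
-- neighbours, so that d v = 2·loop v + S v + 2·D v.  A simple ordered 2-path
-- u v w is an ordered choice of two distinct single-edge neighbours of v, so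
--   b_d = ∑_v S v (S v − 1)   and   b_ℓ = ∑_{v loopless} S v (S v − 1).
-- Both upper bounds follow from S v ≤ d v.  For the lower bounds we bound
-- d(d−1) vertex by vertex: at a loopless vertex (S + 2D)(S + 2D − 1) ≤
-- S(S − 1) + 4ΔD, at a looped vertex d(d−1) ≤ Δ².  Summing, ∑_v D v counts
-- every double edge twice (∑ D = 2m₂) and m₁ vertices carry a loop, giving
-- M₂ ≤ b + 8m₂Δ + m₁Δ².

open import Defs hiding (sym)
open import Defs using () renaming (sym to mult-sym)
open import Data.Nat using (ℕ; zero; suc; _+_; _*_; _≤_; _^_; _∸_; z≤n; s≤s)
open import Data.Nat.Properties hiding (_<?_; _≟_; suc-injective)
open import Data.Fin using (Fin; zero; suc; _<?_)
open import Data.Fin.Properties using (_≟_; suc-injective; toℕ-injective)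
open import Data.Product using (_×_; _,_)
open import Relation.Nullary using (Dec; yes; no; ¬_)
open import Relation.Nullary.Decidable using (_×-dec_; ¬?)
open import Relation.Binary.PropositionalEquality
open import Data.Empty using (⊥-elim)
open import Data.Nat.Tactic.RingSolver using (solve-∀)
import Data.Nat as ℕ

𝟙-× : ∀ {A B : Set} (a : Dec A) (b : Dec B) → 𝟙 (a ×-dec b) ≡ 𝟙 a * 𝟙 b
𝟙-× (yes _) (yes _) = refl
𝟙-× (yes _) (no _)  = refl
𝟙-× (no _)  (yes _) = refl
𝟙-× (no _)  (no _)  = refl

𝟙-⇔ : ∀ {A B : Set} (a : Dec A) (b : Dec B) → (A → B) → (B → A) → 𝟙 a ≡ 𝟙 b
𝟙-⇔ (yes _) (yes _) _ _ = refl
𝟙-⇔ (yes x) (no ¬y) f _ = ⊥-elim (¬y (f x))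
𝟙-⇔ (no ¬x) (yes y) _ g = ⊥-elim (¬x (g y))
𝟙-⇔ (no _)  (no _)  _ _ = refl

𝟙≤1 : ∀ {A : Set} (a : Dec A) → 𝟙 a ≤ 1
𝟙≤1 (yes _) = s≤s z≤n
𝟙≤1 (no _)  = z≤n

𝟙-¬ : ∀ {A : Set} (a : Dec A) → 𝟙 (¬? a) + 𝟙 a ≡ 1
𝟙-¬ (yes _) = refl
𝟙-¬ (no _)  = refl

*𝟙≤ : ∀ {A : Set} x (a : Dec A) → x * 𝟙 a ≤ x
*𝟙≤ x a = ≤-trans (*-monoʳ-≤ x (𝟙≤1 a)) (≤-reflexive (*-identityʳ x))

∑-cong : ∀ {n} {f g : Fin n → ℕ} → (∀ i → f i ≡ g i) → ∑ f ≡ ∑ g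
∑-cong {zero}  _ = refl
∑-cong {suc n} e = cong₂ _+_ (e zero) (∑-cong (λ i → e (suc i)))

∑-mono : ∀ {n} {f g : Fin n → ℕ} → (∀ i → f i ≤ g i) → ∑ f ≤ ∑ g
∑-mono {zero}  _ = z≤n
∑-mono {suc n} e = +-mono-≤ (e zero) (∑-mono (λ i → e (suc i)))

∑-zero : ∀ {n} → ∑ {n} (λ _ → 0) ≡ 0
∑-zero {zero}  = refl
∑-zero {suc n} = ∑-zero {n}

∑-+ : ∀ {n} (f g : Fin n → ℕ) → ∑ (λ i → f i + g i) ≡ ∑ f + ∑ g
∑-+ {zero}  f g = refl
∑-+ {suc n} f g = trans (cong (f zero + g zero +_) (∑-+ (λ i → f (suc i)) (λ i → g (suc i))))
  (interchange (f zero) (g zero) _ _)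
  where
  interchange : ∀ a b c e → (a + b) + (c + e) ≡ (a + c) + (b + e)
  interchange = solve-∀

∑-*ˡ : ∀ {n} (c : ℕ) (f : Fin n → ℕ) → ∑ (λ i → c * f i) ≡ c * ∑ f
∑-*ˡ {zero}  c f = sym (*-zeroʳ c)
∑-*ˡ {suc n} c f = trans (cong (c * f zero +_) (∑-*ˡ c (λ i → f (suc i))))
  (sym (*-distribˡ-+ c (f zero) _))

∑-*ʳ : ∀ {n} (c : ℕ) (f : Fin n → ℕ) → ∑ (λ i → f i * c) ≡ ∑ f * c
∑-*ʳ c f = trans (∑-cong (λ i → *-comm (f i) c)) (trans (∑-*ˡ c f) (*-comm c (∑ f)))

∑-swap : ∀ {n m} (f : Fin n → Fin m → ℕ) →
  ∑ (λ i → ∑ (λ j → f i j)) ≡ ∑ (λ j → ∑ (λ i → f i j))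
∑-swap {zero}  {m} f = sym (∑-zero {m})
∑-swap {suc n} {m} f = begin
    ∑ (f zero) + ∑ (λ i → ∑ (λ j → f (suc i) j))
  ≡⟨ cong (∑ (f zero) +_) (∑-swap (λ i → f (suc i))) ⟩
    ∑ (f zero) + ∑ (λ j → ∑ (λ i → f (suc i) j))
  ≡⟨ sym (∑-+ (f zero) (λ j → ∑ (λ i → f (suc i) j))) ⟩
    ∑ (λ j → f zero j + ∑ (λ i → f (suc i) j))
  ∎ where open ≡-Reasoning

∑-δ : ∀ {n} (u : Fin n) (g : Fin n → ℕ) → ∑ (λ w → g w * 𝟙 (u ≟ w)) ≡ g u
∑-δ {suc n} zero g = begin
    g zero * 1 + ∑ (λ i → g (suc i) * 0)
  ≡⟨ cong₂ _+_ (*-identityʳ (g zero)) (∑-cong (λ i → *-zeroʳ (g (suc i)))) ⟩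
    g zero + ∑ {n} (λ _ → 0)
  ≡⟨ trans (cong (g zero +_) (∑-zero {n})) (+-identityʳ (g zero)) ⟩
    g zero
  ∎ where open ≡-Reasoning
∑-δ {suc n} (suc u) g = begin
    g zero * 0 + ∑ (λ w → g (suc w) * 𝟙 (suc u ≟ suc w))
  ≡⟨ cong (_+ ∑ (λ w → g (suc w) * 𝟙 (suc u ≟ suc w))) (*-zeroʳ (g zero)) ⟩
    ∑ (λ w → g (suc w) * 𝟙 (suc u ≟ suc w))
  ≡⟨ ∑-cong (λ w → cong (g (suc w) *_) (𝟙-⇔ (suc u ≟ suc w) (u ≟ w) suc-injective (cong suc))) ⟩
    ∑ (λ w → g (suc w) * 𝟙 (u ≟ w))
  ≡⟨ ∑-δ u (λ w → g (suc w)) ⟩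
    g (suc u)
  ∎ where open ≡-Reasoning

∑-remove : ∀ {n} (u : Fin n) (f : Fin n → ℕ) →
  ∑ (λ w → f w * 𝟙 (¬? (u ≟ w))) + f u ≡ ∑ f
∑-remove u f = begin
    ∑ (λ w → f w * 𝟙 (¬? (u ≟ w))) + f u
  ≡⟨ cong (∑ (λ w → f w * 𝟙 (¬? (u ≟ w))) +_) (sym (∑-δ u f)) ⟩
    ∑ (λ w → f w * 𝟙 (¬? (u ≟ w))) + ∑ (λ w → f w * 𝟙 (u ≟ w))
  ≡⟨ sym (∑-+ (λ w → f w * 𝟙 (¬? (u ≟ w))) (λ w → f w * 𝟙 (u ≟ w))) ⟩
    ∑ (λ w → f w * 𝟙 (¬? (u ≟ w)) + f w * 𝟙 (u ≟ w))
  ≡⟨ ∑-cong (λ w → trans (sym (*-distribˡ-+ (f w) _ _))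
       (trans (cong (f w *_) (𝟙-¬ (u ≟ w))) (*-identityʳ (f w)))) ⟩
    ∑ f
  ∎ where open ≡-Reasoning

maxF-ub : ∀ {n} (f : Fin n → ℕ) (i : Fin n) → f i ≤ maxF f
maxF-ub f zero    = m≤m⊔n (f zero) _
maxF-ub f (suc i) = m≤n⇒m≤o⊔n (f zero) (maxF-ub (λ j → f (suc j)) i)

pairs-+ : ∀ a b → (a + b) * (a + b ∸ 1) ≤ a * (a ∸ 1) + 2 * b * (a + b)
pairs-+ zero b = begin
    b * (b ∸ 1)   ≤⟨ *-monoʳ-≤ b (m∸n≤m b 1) ⟩
    b * b         ≤⟨ m≤m+n (b * b) (b * b) ⟩
    b * b + b * b ≡⟨ double b ⟩
    2 * b * b     ∎
  where
  open ≤-Reasoning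
  double : ∀ b → b * b + b * b ≡ 2 * b * b
  double = solve-∀
pairs-+ (suc a) b = begin
    (suc a + b) * (a + b)                 ≤⟨ m≤m+n _ (b + b * b) ⟩
    (suc a + b) * (a + b) + (b + b * b)   ≡⟨ expand a b ⟩
    suc a * a + 2 * b * (suc a + b)       ∎
  where
  open ≤-Reasoning
  expand : ∀ a b → (suc a + b) * (a + b) + (b + b * b) ≡ suc a * a + 2 * b * (suc a + b)
  expand = solve-∀

pairs-mono : ∀ {a b} → a ≤ b → a * (a ∸ 1) ≤ b * (b ∸ 1)
pairs-mono h = *-mono-≤ h (∸-monoˡ-≤ 1 h)

pairs≤sq : ∀ {a Δ} → a ≤ Δ → a * (a ∸ 1) ≤ Δ ^ 2
pairs≤sq {a} {Δ} h = begin
    a * (a ∸ 1) ≤⟨ *-monoʳ-≤ a (m∸n≤m a 1) ⟩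
    a * a       ≤⟨ *-mono-≤ h h ⟩
    Δ * Δ       ≡⟨ cong (Δ *_) (sym (*-identityʳ Δ)) ⟩
    Δ ^ 2       ∎ where open ≤-Reasoning

vertex-bound : ∀ l S D d Δ → l ≤ 1 → d ≡ 2 * l + (S + 2 * D) → d ≤ Δ →
  d * (d ∸ 1) ≤ S * (S ∸ 1) * 𝟙 (l ℕ.≟ 0) + (4 * Δ * D + 𝟙 (l ℕ.≟ 1) * (Δ ^ 2))
vertex-bound zero S D d Δ _ refl d≤Δ = begin
    (S + 2 * D) * (S + 2 * D ∸ 1)
  ≤⟨ pairs-+ S (2 * D) ⟩
    S * (S ∸ 1) + 2 * (2 * D) * (S + 2 * D)
  ≤⟨ +-mono-≤ (≤-reflexive (sym (*-identityʳ _))) (*-monoʳ-≤ (2 * (2 * D)) d≤Δ) ⟩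
    S * (S ∸ 1) * 1 + 2 * (2 * D) * Δ
  ≡⟨ cong (S * (S ∸ 1) * 1 +_) (reorder D Δ) ⟩
    S * (S ∸ 1) * 1 + (4 * Δ * D + 0)
  ∎ where
  open ≤-Reasoning
  reorder : ∀ D Δ → 2 * (2 * D) * Δ ≡ 4 * Δ * D + 0
  reorder = solve-∀
vertex-bound (suc zero) S D d Δ _ _ d≤Δ = begin
    d * (d ∸ 1)                                     ≤⟨ pairs≤sq d≤Δ ⟩
    Δ ^ 2                                           ≡⟨ sym (+-identityʳ (Δ ^ 2)) ⟩
    1 * (Δ ^ 2)                                     ≤⟨ m≤n+m _ (4 * Δ * D) ⟩
    4 * Δ * D + 1 * (Δ ^ 2)                         ≤⟨ m≤n+m _ (S * (S ∸ 1) * 0) ⟩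
    S * (S ∸ 1) * 0 + (4 * Δ * D + 1 * (Δ ^ 2))     ∎ where open ≤-Reasoning
vertex-bound (suc (suc l)) S D d Δ (s≤s ()) _ _

indicator-pred : ∀ o X S → o ≤ 1 → X + o ≡ S → o * X ≡ o * (S ∸ 1)
indicator-pred zero          X S _ _ = refl
indicator-pred (suc zero)    X S _ refl = cong (1 *_) (sym (m+n∸n≡m X 1))
indicator-pred (suc (suc o)) X S (s≤s ()) _

mult-split : ∀ x → x ≤ 2 → x ≡ 𝟙 (x ℕ.≟ 1) + 2 * 𝟙 (x ℕ.≟ 2)
mult-split zero                _ = refl
mult-split (suc zero)          _ = refl
mult-split (suc (suc zero))    _ = refl
mult-split (suc (suc (suc x))) (s≤s (s≤s ()))

module Counting {n} (G : Multigraph n) where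

  single double : Fin n → Fin n → ℕ
  single v w = 𝟙 (mult G v w ℕ.≟ 1)
  double v w = 𝟙 (mult G v w ℕ.≟ 2)

  S D : Fin n → ℕ
  S v = ∑ (single v)
  D v = ∑ (double v)

  mult-𝟙-sym : ∀ k u w → 𝟙 (mult G u w ℕ.≟ k) ≡ 𝟙 (mult G w u ℕ.≟ k)
  mult-𝟙-sym k u w = 𝟙-⇔ (mult G u w ℕ.≟ k) (mult G w u ℕ.≟ k)
    (trans (mult-sym G w u)) (trans (mult-sym G u w))

  single⇒distinct : ∀ u v → mult G u v ≡ 1 → ¬ u ≡ v
  single⇒distinct u v e refl with trans (sym e) (irrefl G u)
  ... | ()

  simple2path-𝟙 : ∀ u v w →
    𝟙 (Simple2Path? G u v w) ≡ single u v * (single v w * 𝟙 (¬? (u ≟ w)))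
  simple2path-𝟙 u v w = begin
      𝟙 (Simple2Path? G u v w)
    ≡⟨ 𝟙-⇔ (Simple2Path? G u v w) (uv ×-dec (vw ×-dec ¬? (u ≟ w)))
         (λ { ((_ , _ , u≢w) , (e₁ , e₂)) → e₁ , e₂ , u≢w })
         (λ { (e₁ , e₂ , u≢w) → (single⇒distinct u v e₁ , single⇒distinct v w e₂ , u≢w) , (e₁ , e₂) }) ⟩
      𝟙 (uv ×-dec (vw ×-dec ¬? (u ≟ w)))
    ≡⟨ trans (𝟙-× uv _) (cong (single u v *_) (𝟙-× vw _)) ⟩
      single u v * (single v w * 𝟙 (¬? (u ≟ w)))
    ∎ where
    open ≡-Reasoning
    uv = mult G u v ℕ.≟ 1
    vw = mult G v w ℕ.≟ 1

  -- Simple 2-paths with middle vertex v: ordered pairs of distinct single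
  -- neighbours of v.
  paths-through : ∀ v → ∑ (λ u → ∑ (λ w → 𝟙 (Simple2Path? G u v w))) ≡ S v * (S v ∸ 1)
  paths-through v = begin
      ∑ (λ u → ∑ (λ w → 𝟙 (Simple2Path? G u v w)))
    ≡⟨ ∑-cong (λ u → trans (∑-cong (simple2path-𝟙 u v)) (∑-*ˡ (single u v) (others u))) ⟩
      ∑ (λ u → single u v * ∑ (others u))
    ≡⟨ ∑-cong (λ u → trans (indicator-pred (single u v) (∑ (others u)) (S v)
                             (𝟙≤1 (mult G u v ℕ.≟ 1)) (remove u))
                           (cong (_* (S v ∸ 1)) (mult-𝟙-sym 1 u v))) ⟩
      ∑ (λ u → single v u * (S v ∸ 1))
    ≡⟨ ∑-*ʳ (S v ∸ 1) (single v) ⟩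
      S v * (S v ∸ 1)
    ∎ where
    open ≡-Reasoning
    others : Fin n → Fin n → ℕ
    others u w = single v w * 𝟙 (¬? (u ≟ w))
    remove : ∀ u → ∑ (others u) + single u v ≡ S v
    remove u = trans (cong (∑ (others u) +_) (mult-𝟙-sym 1 u v)) (∑-remove u (single v))

  b-d≡ : b-d G ≡ ∑ (λ v → S v * (S v ∸ 1))
  b-d≡ = trans (∑-swap (λ u v → ∑ (λ w → 𝟙 (Simple2Path? G u v w)))) (∑-cong paths-through)

  b-ℓ≡ : b-ℓ G ≡ ∑ (λ v → S v * (S v ∸ 1) * 𝟙 (loop G v ℕ.≟ 0))
  b-ℓ≡ = trans (∑-swap (λ u v → ∑ (λ w → 𝟙 (Simple2Path? G u v w ×-dec loopless v))))
               (∑-cong loopless-through)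
    where
    loopless : ∀ v → Dec (loop G v ≡ 0)
    loopless v = loop G v ℕ.≟ 0
    loopless-through : ∀ v → ∑ (λ u → ∑ (λ w → 𝟙 (Simple2Path? G u v w ×-dec loopless v)))
                             ≡ S v * (S v ∸ 1) * 𝟙 (loopless v)
    loopless-through v = begin
        ∑ (λ u → ∑ (λ w → 𝟙 (Simple2Path? G u v w ×-dec loopless v)))
      ≡⟨ ∑-cong (λ u → trans (∑-cong (λ w → 𝟙-× (Simple2Path? G u v w) (loopless v)))
                             (∑-*ʳ (𝟙 (loopless v)) (λ w → 𝟙 (Simple2Path? G u v w)))) ⟩
        ∑ (λ u → ∑ (λ w → 𝟙 (Simple2Path? G u v w)) * 𝟙 (loopless v))
      ≡⟨ ∑-*ʳ (𝟙 (loopless v)) (λ u → ∑ (λ w → 𝟙 (Simple2Path? G u v w))) ⟩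
        ∑ (λ u → ∑ (λ w → 𝟙 (Simple2Path? G u v w))) * 𝟙 (loopless v)
      ≡⟨ cong (_* 𝟙 (loopless v)) (paths-through v) ⟩
        S v * (S v ∸ 1) * 𝟙 (loopless v)
      ∎ where open ≡-Reasoning

  degree-split : (d : Fin n → ℕ) → HasDegrees G d → (∀ u w → mult G u w ≤ 2) →
    ∀ v → d v ≡ 2 * loop G v + (S v + 2 * D v)
  degree-split d hd mult≤2 v = trans (sym (hd v)) (cong (2 * loop G v +_) (begin
      ∑ (mult G v)
    ≡⟨ ∑-cong (λ w → mult-split (mult G v w) (mult≤2 v w)) ⟩
      ∑ (λ w → single v w + 2 * double v w)
    ≡⟨ ∑-+ (single v) (λ w → 2 * double v w) ⟩
      S v + ∑ (λ w → 2 * double v w)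
    ≡⟨ cong (S v +_) (∑-*ˡ 2 (double v)) ⟩
      S v + 2 * D v
    ∎)) where open ≡-Reasoning

  -- Each double edge {u, w} is seen from both of its ends.
  ∑D≡2·doubles : ∑ D ≡ numDoubleEdges G + numDoubleEdges G
  ∑D≡2·doubles = begin
      ∑ (λ u → ∑ (double u))
    ≡⟨ ∑-cong (λ u → trans (∑-cong (orient u)) (∑-+ (forward u) (λ w → lt w u * double u w))) ⟩
      ∑ (λ u → ∑ (forward u) + ∑ (λ w → lt w u * double u w))
    ≡⟨ ∑-+ (λ u → ∑ (forward u)) (λ u → ∑ (λ w → lt w u * double u w)) ⟩
      ∑ (λ u → ∑ (forward u)) + ∑ (λ u → ∑ (λ w → lt w u * double u w))
    ≡⟨ cong (∑ (λ u → ∑ (forward u)) +_) (∑-swap (λ u w → lt w u * double u w)) ⟩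
      ∑ (λ u → ∑ (forward u)) + ∑ (λ w → ∑ (λ u → lt w u * double u w))
    ≡⟨ cong (∑ (λ u → ∑ (forward u)) +_)
         (∑-cong (λ w → ∑-cong (λ u → cong (lt w u *_) (mult-𝟙-sym 2 u w)))) ⟩
      ∑ (λ u → ∑ (forward u)) + ∑ (λ w → ∑ (forward w))
    ≡⟨ cong₂ _+_ forward≡ forward≡ ⟩
      numDoubleEdges G + numDoubleEdges G
    ∎ where
    open ≡-Reasoning
    lt : Fin n → Fin n → ℕ
    lt u w = 𝟙 (u <? w)
    forward : Fin n → Fin n → ℕ
    forward u w = lt u w * double u w
    forward≡ : ∑ (λ u → ∑ (forward u)) ≡ numDoubleEdges G
    forward≡ = sym (∑-cong (λ u → ∑-cong (λ w → 𝟙-× (u <? w) (mult G u w ℕ.≟ 2))))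
    no-double-loop : ∀ u → double u u ≡ 0
    no-double-loop u rewrite irrefl G u = refl
    -- every pair u ≠ w is ordered one way
    orient : ∀ u w → double u w ≡ forward u w + lt w u * double u w
    orient u w with u <? w | w <? u
    ... | yes u<w | yes w<u = ⊥-elim (<-asym u<w w<u)
    ... | yes _   | no _    = sym (trans (+-identityʳ _) (*-identityˡ _))
    ... | no _    | yes _   = sym (+-identityʳ _)
    ... | no u≮w  | no w≮u =
      trans (cong (double u) (sym (toℕ-injective (≤-antisym (≮⇒≥ w≮u) (≮⇒≥ u≮w))))) (no-double-loop u)

  -- Bounds for G ∈ 𝒢_{m₁,m₂}(d); they hold for all m₁, m₂.
  module Bounds (d : Fin n → ℕ) (m₁ m₂ : ℕ) (G∈ : InG d m₁ m₂ G) where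
    open InG G∈

    S≤d : ∀ v → S v ≤ d v
    S≤d v = begin
      S v                             ≤⟨ m≤m+n (S v) (2 * D v) ⟩
      S v + 2 * D v                   ≤⟨ m≤n+m _ (2 * loop G v) ⟩
      2 * loop G v + (S v + 2 * D v)  ≡⟨ sym (degree-split d degrees mult≤2 v) ⟩
      d v                             ∎ where open ≤-Reasoning

    sum-bound : (c : Fin n → ℕ) →
      (∀ v → d v * (d v ∸ 1) ≤ c v + (4 * Δ d * D v + 𝟙 (loop G v ℕ.≟ 1) * (Δ d ^ 2))) →
      M₂ d ≤ ∑ c + 8 * m₂ * Δ d + m₁ * (Δ d ^ 2)
    sum-bound c h = begin
        M₂ d
      ≤⟨ ∑-mono h ⟩
        ∑ (λ v → c v + (4 * Δ d * D v + looped v * (Δ d ^ 2)))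
      ≡⟨ trans (∑-+ c _) (cong (∑ c +_) (∑-+ (λ v → 4 * Δ d * D v) (λ v → looped v * (Δ d ^ 2)))) ⟩
        ∑ c + (∑ (λ v → 4 * Δ d * D v) + ∑ (λ v → looped v * (Δ d ^ 2)))
      ≡⟨ cong (∑ c +_) (cong₂ _+_ (∑-*ˡ (4 * Δ d) D) (∑-*ʳ (Δ d ^ 2) looped)) ⟩
        ∑ c + (4 * Δ d * ∑ D + numLoops G * (Δ d ^ 2))
      ≡⟨ cong (∑ c +_) (cong₂ (λ x y → 4 * Δ d * x + y * (Δ d ^ 2))
           (trans ∑D≡2·doubles (cong₂ _+_ dblCount dblCount)) loopCount) ⟩
        ∑ c + (4 * Δ d * (m₂ + m₂) + m₁ * (Δ d ^ 2))
      ≡⟨ regroup (∑ c) (Δ d) m₂ (m₁ * (Δ d ^ 2)) ⟩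
        ∑ c + 8 * m₂ * Δ d + m₁ * (Δ d ^ 2)
      ∎ where
      open ≤-Reasoning
      looped : Fin n → ℕ
      looped v = 𝟙 (loop G v ℕ.≟ 1)
      regroup : ∀ b δ m x → b + (4 * δ * (m + m) + x) ≡ b + 8 * m * δ + x
      regroup = solve-∀

    vertex-bound-G : ∀ v → d v * (d v ∸ 1) ≤ S v * (S v ∸ 1) * 𝟙 (loop G v ℕ.≟ 0)
                            + (4 * Δ d * D v + 𝟙 (loop G v ℕ.≟ 1) * (Δ d ^ 2))
    vertex-bound-G v = vertex-bound (loop G v) (S v) (D v) (d v) (Δ d)
      (loops≤1 v) (degree-split d degrees mult≤2 v) (maxF-ub d v)

    b-ℓ-lower : M₂ d ≤ b-ℓ G + 8 * m₂ * Δ d + m₁ * (Δ d ^ 2)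
    b-ℓ-lower = subst (λ b → M₂ d ≤ b + 8 * m₂ * Δ d + m₁ * (Δ d ^ 2)) (sym b-ℓ≡)
      (sum-bound _ vertex-bound-G)

    b-d-lower : M₂ d ≤ b-d G + 8 * m₂ * Δ d + m₁ * (Δ d ^ 2)
    b-d-lower = subst (λ b → M₂ d ≤ b + 8 * m₂ * Δ d + m₁ * (Δ d ^ 2)) (sym b-d≡)
      (sum-bound _ (λ v → ≤-trans (vertex-bound-G v)
        (+-monoˡ-≤ _ (*𝟙≤ (S v * (S v ∸ 1)) (loop G v ℕ.≟ 0)))))

    b-ℓ-upper : b-ℓ G ≤ M₂ d
    b-ℓ-upper = subst (_≤ M₂ d) (sym b-ℓ≡) (∑-mono (λ v →
      ≤-trans (*𝟙≤ (S v * (S v ∸ 1)) (loop G v ℕ.≟ 0)) (pairs-mono (S≤d v))))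

    b-d-upper : b-d G ≤ M₂ d
    b-d-upper = subst (_≤ M₂ d) (sym b-d≡) (∑-mono (λ v → pairs-mono (S≤d v)))

lemma4p8 : ∀ {n} (d : Fin n → ℕ) →
    (∀ (m₁ m₂ : ℕ) (G : Multigraph n) → InG d m₁ m₂ G →
      m₁ * M d ≤ M₂ d → m₂ * (M d ^ 2) ≤ M₂ d ^ 2 →
      (M₂ d ≤ b-ℓ G + 8 * m₂ * Δ d + m₁ * (Δ d ^ 2)) × (b-ℓ G ≤ M₂ d))
    × (∀ (m₂ : ℕ) (G : Multigraph n) → InG d 0 m₂ G →
      m₂ * (M d ^ 2) ≤ M₂ d ^ 2 →
      (M₂ d ≤ b-d G + 8 * m₂ * Δ d) × (b-d G ≤ M₂ d))
lemma4p8 d =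
  (λ m₁ m₂ G G∈ _ _ → let open Counting.Bounds G d m₁ m₂ G∈ in b-ℓ-lower , b-ℓ-upper) ,
  -- with m₁ = 0 the loop error term m₁Δ² vanishes
  (λ m₂ G G∈ _ → let open Counting.Bounds G d 0 m₂ G∈ in
    subst (M₂ d ≤_) (+-identityʳ _) b-d-lower , b-d-upper)
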